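{- Let $S$ be a special numerical semigroup which is neither irreducible nor ordinary. Then $\{s\in\mathbb{N}\mid \operatorname{m}(S)\le s<\operatorname{F}(S)\}\subseteq S$.
   Context: $\mathbb{N}=\{0,1,2,\ldots\}$. A numerical semigroup is a submonoid $S$ of $(\mathbb{N},+)$ with $\mathbb{N}\setminus S$ finite. $\operatorname{H}(S)=\mathbb{N}\setminus S$; $\operatorname{F}(S)=\max\operatorname{H}(S)$ (Frobenius number, $\operatorname{F}(\mathbb{N})=-1$); $\operatorname{m}(S)=\min(S\setminus\{0\})$. The set of special gaps is $\operatorname{SG}(S)=\{h\in\operatorname{H}(S)\mid 2h\in S \text{ and } h+s\in S \text{ for all } s\in S\setminus\{0\}\}$. $S$ is special if there is no $h\in\operatorname{SG}(S)\setminus\{\operatorname{F}(S)\}$ with $h>\operatorname{m}(S)$. $S$ is irreducible if it cannot be written as the intersection of two numerical semigroups properly containing $S$. $S$ is ordinary if $S=\{0\}\cup\{x\in\mathbb{N}\mid x\ge c\}$ for some $c\in\mathbb{N}$. -}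

module Defs where

open import Data.Nat using (ℕ; zero; suc; _+_; _≤_; _<_)
open import Data.Bool using (Bool; T)
open import Data.Product using (Σ; _×_; ∃; ∃-syntax)
open import Data.Sum using (_⊎_)
open import Relation.Nullary using (¬_)
open import Relation.Binary.PropositionalEquality using (_≡_)

Subset : Set
Subset = ℕ → Bool

_∈_ : ℕ → Subset → Set
x ∈ S = T (S x)

_∉_ : ℕ → Subset → Set
x ∉ S = ¬ (x ∈ S)

infix 4 _∈_ _∉_

record IsNumericalSemigroup (S : Subset) : Set where
  field
    zero∈  : 0 ∈ S
    +-closed : ∀ x y → x ∈ S → y ∈ S → (x + y) ∈ S
    cofinite : ∃[ c ] (∀ x → c ≤ x → x ∈ S)

IsMultiplicity : Subset → ℕ → Set
IsMultiplicity S m = ¬ (m ≡ 0) × m ∈ S × (∀ x → ¬ (x ≡ 0) → x ∈ S → m ≤ x)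

-- f = F(S) = max H(S)   (only for S ≠ ℕ; F(ℕ) = -1 is not a natural number)
IsFrobenius : Subset → ℕ → Set
IsFrobenius S f = f ∉ S × (∀ x → f < x → x ∈ S)

IsSpecialGap : Subset → ℕ → Set
IsSpecialGap S h = h ∉ S × (h + h) ∈ S × (∀ s → s ∈ S → ¬ (s ≡ 0) → (h + s) ∈ S)

IsSpecial : Subset → Set
IsSpecial S = ∀ m h → IsMultiplicity S m → IsSpecialGap S h → m < h → IsFrobenius S h

_⊊_ : Subset → Subset → Set
S ⊊ U = (∀ x → x ∈ S → x ∈ U) × ∃[ x ] (x ∈ U × x ∉ S)

IsIrreducible : Subset → Set
IsIrreducible S = ¬ (Σ Subset λ U → Σ Subset λ V →
   IsNumericalSemigroup U × IsNumericalSemigroup V × S ⊊ U × S ⊊ V ×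
   (∀ x → (x ∈ S → x ∈ U × x ∈ V) × (x ∈ U × x ∈ V → x ∈ S)))

IsOrdinary : Subset → Set
IsOrdinary S = ∃[ c ] (∀ x → (x ∈ S → x ≡ 0 ⊎ c ≤ x) × (x ≡ 0 ⊎ c ≤ x → x ∈ S))

-- If S = U ∩ V with U, V proper oversemigroups, the largest elements of U ∖ S and of
-- V ∖ S are distinct special gaps of S. In a special semigroup every special gap other
-- than F(S) lies below m(S), so S has a special gap h < m(S). Such an h forces every
-- gap g above m(S) to be F(S): going down from F(S), if F(S) is the only gap above g,
-- then g + t ∈ S for all t > h (otherwise g + t and g + t − h would be two gaps above
-- g, both equal to F(S)), so g is a special gap larger than m(S), hence g = F(S).
module Submission where

open import Defs
open import Data.Nat using (ℕ; zero; suc; _+_; _∸_; _≤_; _<_; z≤n; s≤s; z<s)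
open import Data.Nat.Properties
open import Data.Empty using (⊥)
open import Data.Product using (_×_; _,_; ∃; proj₁; proj₂)
open import Data.Sum using (_⊎_; inj₁; inj₂)
open import Relation.Nullary using (¬_; yes; no; contradiction)
open import Relation.Nullary.Decidable using (T?; ¬?; _×-dec_; decidable-stable)
open import Relation.Unary using (Decidable)
open import Relation.Binary.PropositionalEquality
  using (_≡_; _≢_; refl; sym; trans; cong; subst; module ≡-Reasoning)
open import Relation.Binary.Definitions using (tri<; tri≈; tri>)

bounded⇒∃-max : {P : ℕ → Set} → Decidable P → ∀ n → (∀ y → n ≤ y → ¬ P y) →
  ∀ {x} → P x → ∃ λ h → P h × (∀ y → h < y → ¬ P y)
bounded⇒∃-max P? zero    bound {x} px = contradiction px (bound x z≤n)
bounded⇒∃-max {P} P? (suc k) bound px with P? k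
... | yes pk = k , pk , bound
... | no ¬pk = bounded⇒∃-max P? k bound′ px
  where
  bound′ : ∀ y → k ≤ y → ¬ P y
  bound′ y k≤y with m≤n⇒m<n∨m≡n k≤y
  ... | inj₁ k<y = bound y k<y
  ... | inj₂ refl = ¬pk

downward-induction : (P : ℕ → Set) {m f : ℕ} → (∀ g → f ≤ g → P g) →
  (∀ g → m ≤ g → P (suc g) → P g) → ∀ g → m ≤ g → P g
downward-induction P {m} {f} top step g = go (f ∸ g) g (m≤n+m∸n f g)
  where
  go : ∀ k g → f ≤ g + k → m ≤ g → P g
  go zero    g f≤g+0 _   = top g (subst (f ≤_) (+-identityʳ g) f≤g+0)
  go (suc k) g f≤g+k m≤g =
    step g m≤g (go k (suc g) (subst (f ≤_) (+-suc g k) f≤g+k) (m≤n⇒m≤1+n m≤g))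

module _ {S : Subset} where

  gap⇒≢0 : IsNumericalSemigroup S → ∀ {h} → h ∉ S → h ≢ 0
  gap⇒≢0 ns h∉S refl = h∉S (IsNumericalSemigroup.zero∈ ns)

  frobenius-unique : ∀ {a b} → IsFrobenius S a → IsFrobenius S b → a ≡ b
  frobenius-unique {a} {b} (a∉S , above-a) (b∉S , above-b) with <-cmp a b
  ... | tri< a<b _ _ = contradiction (above-a b a<b) b∉S
  ... | tri≈ _ a≡b _ = a≡b
  ... | tri> _ _ b<a = contradiction (above-b a b<a) a∉S

  special⇒specialGap<m⊎≡F : IsSpecial S → ∀ {m f h} → IsMultiplicity S m →
    IsFrobenius S f → IsSpecialGap S h → h < m ⊎ h ≡ f
  special⇒specialGap<m⊎≡F sp {m} {f} {h} mm fr sg with <-cmp h m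
  ... | tri< h<m _ _ = inj₁ h<m
  ... | tri≈ _ refl _ = contradiction (proj₁ (proj₂ mm)) (proj₁ sg)
  ... | tri> _ _ m<h = inj₂ (frobenius-unique (sp m h mm sg m<h) fr)

  maxDifference⇒specialGap : IsNumericalSemigroup S → ∀ {U} → IsNumericalSemigroup U →
    (∀ x → x ∈ S → x ∈ U) → ∀ {h} → h ∈ U → h ∉ S →
    (∀ y → h < y → ¬ (y ∈ U × y ∉ S)) → IsSpecialGap S h
  maxDifference⇒specialGap ns {U} nsU S⊆U {h} h∈U h∉S maximal =
    h∉S ,
    in-S (m<m+n h h>0) (+-closed h h h∈U h∈U) ,
    λ s s∈S s≢0 → in-S (m<m+n h (n≢0⇒n>0 s≢0)) (+-closed h s h∈U (S⊆U s s∈S))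
    where
    open IsNumericalSemigroup nsU using (+-closed)
    h>0 : 0 < h
    h>0 = n≢0⇒n>0 (gap⇒≢0 ns h∉S)
    in-S : ∀ {y} → h < y → y ∈ U → y ∈ S
    in-S {y} h<y y∈U = decidable-stable (T? (S y)) λ y∉S → maximal y h<y (y∈U , y∉S)

  properOversemigroup⇒specialGap : IsNumericalSemigroup S → ∀ {U} →
    IsNumericalSemigroup U → S ⊊ U → ∃ λ h → h ∈ U × IsSpecialGap S h
  properOversemigroup⇒specialGap ns {U} nsU (S⊆U , x , x∈U , x∉S)
    with IsNumericalSemigroup.cofinite ns
  ... | c , cofinite
    with bounded⇒∃-max (λ y → T? (U y) ×-dec ¬? (T? (S y))) c
           (λ y c≤y (_ , y∉S) → y∉S (cofinite y c≤y)) (x∈U , x∉S)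
  ... | h , (h∈U , h∉S) , maximal =
    h , h∈U , maxDifference⇒specialGap ns nsU S⊆U h∈U h∉S maximal

  atMostOneSpecialGap⇒irreducible : IsNumericalSemigroup S →
    (∀ {h h′} → IsSpecialGap S h → IsSpecialGap S h′ → h ≡ h′) → IsIrreducible S
  atMostOneSpecialGap⇒irreducible ns unique (U , V , nsU , nsV , S⊊U , S⊊V , S≡U∩V)
    with properOversemigroup⇒specialGap ns nsU S⊊U | properOversemigroup⇒specialGap ns nsV S⊊V
  ... | h , h∈U , sg | h′ , h′∈V , sg′ =
    proj₁ sg (proj₂ (S≡U∩V h) (h∈U , subst (_∈ V) (unique sg′ sg) h′∈V))

  SoleGapAbove : ℕ → ℕ → Set
  SoleGapAbove g f = ∀ x → g < x → x ∉ S → x ≡ f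

  specialGap-shift : IsNumericalSemigroup S → ∀ {h g f} → IsSpecialGap S h →
    SoleGapAbove g f → ∀ t → h < t → g + t ∈ S
  specialGap-shift ns {h} {g} {f} (h∉S , _ , h+S⊆S) sole t h<t with m≤n⇒∃[o]m+o≡n h<t
  ... | d , refl = decidable-stable (T? (S x)) λ x∉S → gap⇒≢0 ns h∉S (h≡0 x∉S)
    where
    x y : ℕ
    x = g + (suc h + d)
    y = g + suc d
    h+y≡x : h + y ≡ x
    h+y≡x = begin
      h + (g + suc d)   ≡⟨ sym (+-assoc h g (suc d)) ⟩
      h + g + suc d     ≡⟨ cong (_+ suc d) (+-comm h g) ⟩
      g + h + suc d     ≡⟨ +-assoc g h (suc d) ⟩
      g + (h + suc d)   ≡⟨ cong (g +_) (+-suc h d) ⟩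
      g + (suc h + d)   ∎
      where open ≡-Reasoning
    y∉S : x ∉ S → y ∉ S
    y∉S x∉S y∈S = x∉S (subst (_∈ S) h+y≡x (h+S⊆S _ y∈S (m+1+n≢0 g)))
    h≡0 : x ∉ S → h ≡ 0
    h≡0 x∉S = +-cancelʳ-≡ d h 0 (sym (suc-injective (+-cancelˡ-≡ g _ _ y≡x)))
      where
      y≡x : y ≡ x
      y≡x = trans (sole y (m<m+n g z<s) (y∉S x∉S)) (sym (sole x (m<m+n g z<s) x∉S))

  module _ (ns : IsNumericalSemigroup S) (sp : IsSpecial S)
    {m f : ℕ} (mm : IsMultiplicity S m) (fr : IsFrobenius S f)
    {h : ℕ} (hsg : IsSpecialGap S h) (h<m : h < m) where

    soleGapAbove⇒specialGap : ∀ {g} → m < g → g ∉ S → SoleGapAbove g f → IsSpecialGap S g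
    soleGapAbove⇒specialGap {g} m<g g∉S sole =
      g∉S ,
      shift g (<-trans h<m m<g) ,
      λ s s∈S s≢0 → shift s (<-≤-trans h<m (proj₂ (proj₂ mm) s s≢0 s∈S))
      where
      shift : ∀ t → h < t → g + t ∈ S
      shift = specialGap-shift ns hsg sole

    soleGapAbove-step : ∀ g → m ≤ g → SoleGapAbove (suc g) f → SoleGapAbove g f
    soleGapAbove-step g m≤g sole x g<x x∉S with m≤n⇒m<n∨m≡n g<x
    ... | inj₁ 1+g<x = sole x 1+g<x x∉S
    ... | inj₂ refl =
      frobenius-unique (sp m x mm (soleGapAbove⇒specialGap (s≤s m≤g) x∉S sole) (s≤s m≤g)) fr

    soleGapAbove-multiplicity : SoleGapAbove m f
    soleGapAbove-multiplicity =
      downward-induction (λ g → SoleGapAbove g f)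
        (λ g f≤g x g<x x∉S → contradiction (proj₂ fr x (≤-<-trans f≤g g<x)) x∉S)
        soleGapAbove-step m ≤-refl

    specialGap<m⇒interval⊆S : ∀ s → m ≤ s → s < f → s ∈ S
    specialGap<m⇒interval⊆S s m≤s s<f = decidable-stable (T? (S s)) λ s∉S →
      [m,s]-case s∉S (m≤n⇒m<n∨m≡n m≤s)
      where
      [m,s]-case : s ∉ S → m < s ⊎ m ≡ s → ⊥
      [m,s]-case s∉S (inj₁ m<s) = <⇒≢ s<f (soleGapAbove-multiplicity s m<s s∉S)
      [m,s]-case s∉S (inj₂ refl) = s∉S (proj₁ (proj₂ mm))

theorem3p6 : (S : Subset) → IsNumericalSemigroup S → IsSpecial S →
    ¬ IsIrreducible S → ¬ IsOrdinary S →
    ∀ m f → IsMultiplicity S m → IsFrobenius S f →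
    ∀ s → m ≤ s → s < f → s ∈ S
theorem3p6 S ns sp ¬irreducible _ m f mm fr s m≤s s<f =
  decidable-stable (T? (S s)) λ s∉S →
    ¬irreducible (atMostOneSpecialGap⇒irreducible ns λ sg sg′ →
      trans (specialGap≡F s∉S sg) (sym (specialGap≡F s∉S sg′)))
  where
  specialGap≡F : s ∉ S → ∀ {h} → IsSpecialGap S h → h ≡ f
  specialGap≡F s∉S sg with special⇒specialGap<m⊎≡F sp mm fr sg
  ... | inj₁ h<m = contradiction (specialGap<m⇒interval⊆S ns sp mm fr sg h<m s m≤s s<f) s∉S
  ... | inj₂ h≡f = h≡f
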